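{- Let $n\ge2$ and $d\ge1$ be integers, and let $u_1,\dots,u_n\in(2\mathbb{Z}_{\ge 0})^n$ be points each of whose coordinate sums equals $2d$, such that $\mathcal U=\mathrm{conv}\{u_1,\dots,u_n\}$ is an $(n-1)$-dimensional simplex. If $k$ is an integer with $k\ge n-1$, then $k\mathcal U\cap\mathbb{Z}^n$ is $(k\mathcal U)$-mediated.
   Context: For a simplex $\mathcal V=\mathrm{conv}\{v_1,\dots,v_n\}$ with vertices $v_i\in(2\mathbb{Z})^n$, a set $S\subseteq \mathcal V\cap\mathbb{Z}^n$ containing all vertices $v_i$ is called $\mathcal V$-mediated if every $y\in S$ either equals some vertex $v_i$, or there exist $z_1\neq z_2$ in $S\cap(2\mathbb{Z})^n$ with $y=\tfrac12(z_1+z_2)$. Here $k\mathcal U$ is the simplex with vertices $ku_1,\dots,ku_n$. -}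

module Defs where

open import Data.Nat as ℕ using (ℕ)
open import Data.Fin using (Fin; zero; suc)
open import Data.Integer as ℤ using (ℤ; +_)
open import Data.Rational as ℚ using (ℚ; 0ℚ; 1ℚ; _/_)
open import Data.Product using (Σ; ∃; _×_)
open import Data.Sum using (_⊎_)
open import Relation.Nullary using (¬_)
open import Relation.Binary.PropositionalEquality using (_≡_)

Point : ℕ → Set
Point n = Fin n → ℤ

toℚ : ℤ → ℚ
toℚ z = z / 1

sumℤ : ∀ {n} → (Fin n → ℤ) → ℤ
sumℤ {ℕ.zero}  f = + 0
sumℤ {ℕ.suc n} f = f zero ℤ.+ sumℤ (λ i → f (suc i))

sumℚ : ∀ {n} → (Fin n → ℚ) → ℚ
sumℚ {ℕ.zero}  f = 0ℚ
sumℚ {ℕ.suc n} f = f zero ℚ.+ sumℚ (λ i → f (suc i))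

Even : ℤ → Set
Even z = ∃ λ m → z ≡ + 2 ℤ.* m

EvenPt : ∀ {n} → Point n → Set
EvenPt y = ∀ j → Even (y j)

_≐_ : ∀ {n} → Point n → Point n → Set
y ≐ z = ∀ j → y j ≡ z j

-- scaling a family of points: k𝒰 has vertices k u₁, …, k uₙ
scale : ∀ {m n} → ℕ → (Fin m → Point n) → (Fin m → Point n)
scale k u i j = + k ℤ.* u i j

-- y lies in conv{v₁,…,v_m}: convex combination (rational coefficients suffice
-- for rational data)
InConv : ∀ {m n} → (Fin m → Point n) → Point n → Set
InConv v y = Σ (Fin _ → ℚ) λ c →
  (∀ i → 0ℚ ℚ.≤ c i) × (sumℚ c ≡ 1ℚ) ×
  (∀ j → toℚ (y j) ≡ sumℚ (λ i → c i ℚ.* toℚ (v i j)))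

-- v₁,…,v_m affinely independent (so conv is an (m-1)-dimensional simplex)
AffInd : ∀ {m n} → (Fin m → Point n) → Set
AffInd v = ∀ (μ : Fin _ → ℚ) → sumℚ μ ≡ 0ℚ →
  (∀ j → sumℚ (λ i → μ i ℚ.* toℚ (v i j)) ≡ 0ℚ) → ∀ i → μ i ≡ 0ℚ

Mediated : ∀ {m n} → (Fin m → Point n) → (Point n → Set) → Set
Mediated v S =
  (∀ y → S y → InConv v y) ×
  (∀ i → S (v i)) ×
  (∀ y → S y →
     (∃ λ i → y ≐ v i) ⊎
     (Σ (Point _) λ z₁ → Σ (Point _) λ z₂ →
        S z₁ × S z₂ × EvenPt z₁ × EvenPt z₂ × ¬ (z₁ ≐ z₂) ×
        (∀ j → z₁ j ℤ.+ z₂ j ≡ + 2 ℤ.* y j)))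

module Submission where

-- Write y ∈ k𝒰 as Σ αᵢ uᵢ with αᵢ ≥ 0 and Σ αᵢ = k.  The floors mᵢ = ⌊2αᵢ⌋ add up
-- to more than 2k − n ≥ k − 1, so there are integers 0 ≤ Bᵢ ≤ mᵢ with Σ Bᵢ = k.
-- Then z₂ = Σ Bᵢ uᵢ and z₁ = 2y − z₂ = Σ (2αᵢ − Bᵢ) uᵢ are even lattice points of
-- k𝒰 with midpoint y.  They coincide only if y = z₂; then affine independence
-- gives αᵢ = Bᵢ, hence mᵢ = 2Bᵢ, and choosing B greedily puts all of k on a single
-- index, so y is a vertex.

open import Defs
open import Data.Nat using (ℕ; _≤_; _∸_)
open import Data.Fin using (Fin)
open import Data.Integer as ℤ using (+_)
open import Relation.Binary.PropositionalEquality using (_≡_)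

open import Data.Nat as ℕ using (zero; suc; _<_; _⊓_; z≤n; s≤s)
import Data.Nat.Properties as ℕP
open import Data.Nat.DivMod using (_/_; m/n*n≤m; m≡m%n+[m/n]*n; m%n<n)
open import Data.Fin using (zero; suc)
import Data.Fin.Properties as FinP
open ℤ using (ℤ; -[1+_])
import Data.Integer.Properties as ℤP
open import Data.Integer.Tactic.RingSolver using (solve-∀)
open import Data.Rational as ℚ using (ℚ; mkℚ; 0ℚ; 1ℚ; *≤*; *<*)
import Data.Rational.Properties as ℚP
open import Data.Rational.Solver using (module +-*-Solver)
import Data.Rational.Unnormalised as ℚᵘ
import Data.Rational.Unnormalised.Properties as ℚᵘP
import Data.Nat.Coprimality as Coprime
open import Algebra.Properties.Group ℚP.+-0-group using (x∙y⁻¹≈ε⇒x≈y)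
open import Data.Product using (Σ; ∃; _×_; _,_; proj₁; proj₂)
open import Data.Sum using (_⊎_; inj₁; inj₂)
open import Data.Empty using (⊥-elim)
open import Relation.Nullary using (¬_; yes; no)
open import Relation.Binary.PropositionalEquality
  using (refl; sym; trans; cong; cong₂; subst; subst₂; module ≡-Reasoning)
open +-*-Solver using (solve; _:+_; _:*_; _:-_; _:=_)

-- toℚ z normalises z / 1; ι z is the same rational built in normal form, so it computes.
private
  ι : ℤ → ℚ
  ι z = mkℚ z 0 (Coprime.sym (Coprime.1-coprimeTo _))

  toℚ≡ι : ∀ z → toℚ z ≡ ι z
  toℚ≡ι z = ℚP.↥p/↧p≡p (ι z)

toℚ-+ : ∀ a b → toℚ (a ℤ.+ b) ≡ toℚ a ℚ.+ toℚ b
toℚ-+ a b rewrite toℚ≡ι (a ℤ.+ b) | toℚ≡ι a | toℚ≡ι b =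
  ℚP.toℚᵘ-injective (ℚᵘP.≃-trans (ℚᵘ.*≡* (ident a b)) (ℚᵘP.≃-sym (ℚP.toℚᵘ-homo-+ (ι a) (ι b))))
  where
  ident : ∀ a b → (a ℤ.+ b) ℤ.* + 1 ≡ (a ℤ.* + 1 ℤ.+ b ℤ.* + 1) ℤ.* + 1
  ident = solve-∀

toℚ-* : ∀ a b → toℚ (a ℤ.* b) ≡ toℚ a ℚ.* toℚ b
toℚ-* a b rewrite toℚ≡ι (a ℤ.* b) | toℚ≡ι a | toℚ≡ι b =
  ℚP.toℚᵘ-injective (ℚᵘP.≃-sym (ℚP.toℚᵘ-homo-* (ι a) (ι b)))

toℚ-neg : ∀ a → toℚ (ℤ.- a) ≡ ℚ.- toℚ a
toℚ-neg a rewrite toℚ≡ι (ℤ.- a) | toℚ≡ι a =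
  ℚP.toℚᵘ-injective (ℚᵘP.≃-sym (ℚP.toℚᵘ-homo‿- (ι a)))

toℚ-- : ∀ a b → toℚ (a ℤ.- b) ≡ toℚ a ℚ.- toℚ b
toℚ-- a b = trans (toℚ-+ a (ℤ.- b)) (cong (toℚ a ℚ.+_) (toℚ-neg b))

toℚ-mono-≤ : ∀ {a b} → a ℤ.≤ b → toℚ a ℚ.≤ toℚ b
toℚ-mono-≤ {a} {b} a≤b rewrite toℚ≡ι a | toℚ≡ι b =
  *≤* (subst₂ ℤ._≤_ (sym (ℤP.*-identityʳ a)) (sym (ℤP.*-identityʳ b)) a≤b)

toℚ-cancel-≤ : ∀ {a b} → toℚ a ℚ.≤ toℚ b → a ℤ.≤ b
toℚ-cancel-≤ {a} {b} p rewrite toℚ≡ι a | toℚ≡ι b with p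
... | *≤* a≤b = subst₂ ℤ._≤_ (ℤP.*-identityʳ a) (ℤP.*-identityʳ b) a≤b

toℚ-mono-< : ∀ {a b} → a ℤ.< b → toℚ a ℚ.< toℚ b
toℚ-mono-< {a} {b} a<b rewrite toℚ≡ι a | toℚ≡ι b =
  *<* (subst₂ ℤ._<_ (sym (ℤP.*-identityʳ a)) (sym (ℤP.*-identityʳ b)) a<b)

toℚ-cancel-< : ∀ {a b} → toℚ a ℚ.< toℚ b → a ℤ.< b
toℚ-cancel-< {a} {b} p rewrite toℚ≡ι a | toℚ≡ι b with p
... | *<* a<b = subst₂ ℤ._<_ (ℤP.*-identityʳ a) (ℤP.*-identityʳ b) a<b

∃-floor : ∀ q → 0ℚ ℚ.≤ q → ∃ λ m → toℚ (+ m) ℚ.≤ q × q ℚ.< toℚ (+ suc m)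
∃-floor (mkℚ -[1+ a ] b _) (*≤* ())
∃-floor q@(mkℚ (+ a) b _) _ = a / suc b , lower , upper
  where
  lower : toℚ (+ (a / suc b)) ℚ.≤ q
  lower rewrite toℚ≡ι (+ (a / suc b)) =
    *≤* (subst₂ ℤ._≤_ (ℤP.pos-* (a / suc b) (suc b)) (sym (ℤP.*-identityʳ (+ a)))
          (ℤ.+≤+ (m/n*n≤m a (suc b))))
  a<next : a < suc (a / suc b) ℕ.* suc b
  a<next = subst (_< suc (a / suc b) ℕ.* suc b) (sym (m≡m%n+[m/n]*n a (suc b)))
             (ℕP.+-monoˡ-< ((a / suc b) ℕ.* suc b) (m%n<n a (suc b)))
  upper : q ℚ.< toℚ (+ suc (a / suc b))
  upper rewrite toℚ≡ι (+ suc (a / suc b)) =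
    *<* (subst₂ ℤ._<_ (sym (ℤP.*-identityʳ (+ a))) (ℤP.pos-* (suc (a / suc b)) (suc b))
          (ℤ.+<+ a<next))

toℚ-double : ∀ a → toℚ (+ (a ℕ.+ a)) ≡ toℚ (+ a) ℚ.+ toℚ (+ a)
toℚ-double a = trans (cong toℚ (ℤP.pos-+ a a)) (toℚ-+ (+ a) (+ a))

toℚ-nonNeg : ∀ n → 0ℚ ℚ.≤ toℚ (+ n)
toℚ-nonNeg n = toℚ-mono-≤ {+ 0} {+ n} (ℤ.+≤+ z≤n)

*-nonNeg : ∀ {p q} → 0ℚ ℚ.≤ p → 0ℚ ℚ.≤ q → 0ℚ ℚ.≤ p ℚ.* q
*-nonNeg {p} {q} 0≤p 0≤q =
  ℚP.nonNegative⁻¹ _ {{ℚP.nonNeg*nonNeg⇒nonNeg p {{ℚ.nonNegative 0≤p}} q {{ℚ.nonNegative 0≤q}}}}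

floor-unique : ∀ {m b} → toℚ (+ m) ℚ.≤ toℚ (+ b) → toℚ (+ b) ℚ.< toℚ (+ suc m) → m ≡ b
floor-unique {m} {b} m≤b b<m+1 =
  ℕP.≤-antisym (ℤP.drop‿+≤+ (toℚ-cancel-≤ {+ m} {+ b} m≤b))
               (ℕP.<⇒≤pred (ℤP.drop‿+<+ (toℚ-cancel-< {+ b} {+ suc m} b<m+1)))

sumℕ : ∀ {n} → (Fin n → ℕ) → ℕ
sumℕ {zero}  f = 0
sumℕ {suc n} f = f zero ℕ.+ sumℕ (λ i → f (suc i))

sumℕ-suc : ∀ {n} (f : Fin n → ℕ) → sumℕ (λ i → suc (f i)) ≡ n ℕ.+ sumℕ f
sumℕ-suc {zero}  f = refl
sumℕ-suc {suc n} f = cong suc (begin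
  f zero ℕ.+ sumℕ (λ i → suc (f (suc i)))  ≡⟨ cong (f zero ℕ.+_) (sumℕ-suc (λ i → f (suc i))) ⟩
  f zero ℕ.+ (n ℕ.+ sumℕ (λ i → f (suc i))) ≡⟨ ℕP.+-comm (f zero) _ ⟩
  (n ℕ.+ sumℕ (λ i → f (suc i))) ℕ.+ f zero ≡⟨ ℕP.+-assoc n _ (f zero) ⟩
  n ℕ.+ (sumℕ (λ i → f (suc i)) ℕ.+ f zero) ≡⟨ cong (n ℕ.+_) (ℕP.+-comm _ (f zero)) ⟩
  n ℕ.+ sumℕ f                               ∎)
  where open ≡-Reasoning

sumℤ-cong : ∀ {n} {f g : Fin n → ℤ} → (∀ i → f i ≡ g i) → sumℤ f ≡ sumℤ g
sumℤ-cong {zero}  f≗g = refl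
sumℤ-cong {suc n} f≗g = cong₂ ℤ._+_ (f≗g zero) (sumℤ-cong (λ i → f≗g (suc i)))

sumℚ-cong : ∀ {n} {f g : Fin n → ℚ} → (∀ i → f i ≡ g i) → sumℚ f ≡ sumℚ g
sumℚ-cong {zero}  f≗g = refl
sumℚ-cong {suc n} f≗g = cong₂ ℚ._+_ (f≗g zero) (sumℚ-cong (λ i → f≗g (suc i)))

pos-sumℕ : ∀ {n} (f : Fin n → ℕ) → + sumℕ f ≡ sumℤ (λ i → + f i)
pos-sumℕ {zero}  f = refl
pos-sumℕ {suc n} f = trans (ℤP.pos-+ (f zero) _) (cong (ℤ._+_ (+ f zero)) (pos-sumℕ (λ i → f (suc i))))

toℚ-sumℤ : ∀ {n} (f : Fin n → ℤ) → toℚ (sumℤ f) ≡ sumℚ (λ i → toℚ (f i))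
toℚ-sumℤ {zero}  f = refl
toℚ-sumℤ {suc n} f = trans (toℚ-+ (f zero) _) (cong (toℚ (f zero) ℚ.+_) (toℚ-sumℤ (λ i → f (suc i))))

sumℤ-zero : ∀ n → sumℤ {n} (λ _ → + 0) ≡ + 0
sumℤ-zero zero    = refl
sumℤ-zero (suc n) = trans (ℤP.+-identityˡ _) (sumℤ-zero n)

sumℚ-zero : ∀ n → sumℚ {n} (λ _ → 0ℚ) ≡ 0ℚ
sumℚ-zero zero    = refl
sumℚ-zero (suc n) = trans (ℚP.+-identityˡ _) (sumℚ-zero n)

sumℚ-distrib-+ : ∀ {n} (f g : Fin n → ℚ) → sumℚ (λ i → f i ℚ.+ g i) ≡ sumℚ f ℚ.+ sumℚ g
sumℚ-distrib-+ {zero}  f g = refl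
sumℚ-distrib-+ {suc n} f g =
  trans (cong (f zero ℚ.+ g zero ℚ.+_) (sumℚ-distrib-+ (λ i → f (suc i)) (λ i → g (suc i))))
        (solve 4 (λ a b c d → (a :+ b) :+ (c :+ d) := (a :+ c) :+ (b :+ d)) refl
          (f zero) (g zero) (sumℚ (λ i → f (suc i))) (sumℚ (λ i → g (suc i))))

sumℚ-neg : ∀ {n} (f : Fin n → ℚ) → sumℚ (λ i → ℚ.- f i) ≡ ℚ.- sumℚ f
sumℚ-neg {zero}  f = refl
sumℚ-neg {suc n} f = trans (cong (ℚ.- f zero ℚ.+_) (sumℚ-neg (λ i → f (suc i))))
                           (sym (ℚP.neg-distrib-+ (f zero) _))

sumℚ-distrib-- : ∀ {n} (f g : Fin n → ℚ) → sumℚ (λ i → f i ℚ.- g i) ≡ sumℚ f ℚ.- sumℚ g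
sumℚ-distrib-- f g = trans (sumℚ-distrib-+ f (λ i → ℚ.- g i)) (cong (sumℚ f ℚ.+_) (sumℚ-neg g))

*-distribˡ-sumℚ : ∀ {n} a (f : Fin n → ℚ) → sumℚ (λ i → a ℚ.* f i) ≡ a ℚ.* sumℚ f
*-distribˡ-sumℚ {zero}  a f = sym (ℚP.*-zeroʳ a)
*-distribˡ-sumℚ {suc n} a f = trans (cong (a ℚ.* f zero ℚ.+_) (*-distribˡ-sumℚ a (λ i → f (suc i))))
                                    (sym (ℚP.*-distribˡ-+ a (f zero) _))

*-distribʳ-sumℚ : ∀ {n} a (f : Fin n → ℚ) → sumℚ (λ i → f i ℚ.* a) ≡ sumℚ f ℚ.* a
*-distribʳ-sumℚ a f = trans (sumℚ-cong (λ i → ℚP.*-comm (f i) a))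
                            (trans (*-distribˡ-sumℚ a f) (ℚP.*-comm a _))

sumℚ-mono-≤ : ∀ {n} {f g : Fin n → ℚ} → (∀ i → f i ℚ.≤ g i) → sumℚ f ℚ.≤ sumℚ g
sumℚ-mono-≤ {zero}  f≤g = ℚP.≤-refl
sumℚ-mono-≤ {suc n} f≤g = ℚP.+-mono-≤ (f≤g zero) (sumℚ-mono-≤ (λ i → f≤g (suc i)))

sumℚ-mono-< : ∀ {n} {f g : Fin (suc n) → ℚ} → (∀ i → f i ℚ.< g i) → sumℚ f ℚ.< sumℚ g
sumℚ-mono-< f<g = ℚP.+-mono-<-≤ (f<g zero) (sumℚ-mono-≤ (λ i → ℚP.<⇒≤ (f<g (suc i))))

sum-floors-≥ : ∀ {n} k (t : Fin n → ℚ) (m : Fin n → ℕ) → 1 ≤ n → n ≤ suc k →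
  sumℚ t ≡ toℚ (+ (k ℕ.+ k)) → (∀ i → t i ℚ.< toℚ (+ suc (m i))) → k ≤ sumℕ m
sum-floors-≥ {suc n} k t m _ n≤1+k Σt t<m+1 =
  ℕP.+-cancelˡ-≤ k k (sumℕ m) (ℕP.<⇒≤pred (ℕP.<-≤-trans 2k<n+Σm (ℕP.+-monoˡ-≤ (sumℕ m) n≤1+k)))
  where
  2k<n+Σm : k ℕ.+ k < suc n ℕ.+ sumℕ m
  2k<n+Σm = subst (k ℕ.+ k <_) (sumℕ-suc m) (ℤP.drop‿+<+ (toℚ-cancel-<
    (subst₂ ℚ._<_ Σt
      (trans (sym (toℚ-sumℤ (λ i → + suc (m i)))) (cong toℚ (sym (pos-sumℕ (λ i → suc (m i))))))
      (sumℚ-mono-< t<m+1))))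

-- Greedy filling of capacities

greedy : ∀ {n} → ℕ → (Fin n → ℕ) → Fin n → ℕ
greedy k m zero    = m zero ⊓ k
greedy k m (suc i) = greedy (k ∸ m zero) (λ i → m (suc i)) i

greedy-≤ : ∀ {n} k (m : Fin n → ℕ) i → greedy k m i ≤ m i
greedy-≤ k m zero    = ℕP.m⊓n≤m (m zero) k
greedy-≤ k m (suc i) = greedy-≤ (k ∸ m zero) (λ i → m (suc i)) i

greedy-sum : ∀ {n} k (m : Fin n → ℕ) → k ≤ sumℕ m → sumℕ (greedy k m) ≡ k
greedy-sum {zero}  .0 m z≤n = refl
greedy-sum {suc n} k  m k≤Σm =
  trans (cong (m zero ⊓ k ℕ.+_)
              (greedy-sum (k ∸ m zero) (λ i → m (suc i)) (ℕP.m≤n+o⇒m∸n≤o k (m zero) k≤Σm)))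
        (ℕP.m⊓n+n∸m≡n (m zero) k)

greedy-zero : ∀ {n} (m : Fin n → ℕ) i → greedy 0 m i ≡ 0
greedy-zero m zero    = ℕP.⊓-zeroʳ (m zero)
greedy-zero m (suc i) = trans (cong (λ r → greedy r (λ i → m (suc i)) i) (ℕP.0∸n≡0 (m zero)))
                              (greedy-zero (λ i → m (suc i)) i)

greedy-skip : ∀ {n} k (m : Fin (suc n) → ℕ) → m zero ≡ 0 →
  ∀ i → greedy k m (suc i) ≡ greedy k (λ i → m (suc i)) i
greedy-skip k m m₀≡0 i = cong (λ x → greedy (k ∸ x) (λ i → m (suc i)) i) m₀≡0

greedy-fits-first : ∀ {n} k (m : Fin (suc n) → ℕ) → k ≤ m zero → ∀ (f : Fin (suc n) → ℤ) →
  sumℤ (λ i → + greedy k m i ℤ.* f i) ≡ + k ℤ.* f zero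
greedy-fits-first {n} k m k≤m₀ f = begin
  + (m zero ⊓ k) ℤ.* f zero ℤ.+ sumℤ (λ i → + greedy (k ∸ m zero) m′ i ℤ.* f (suc i))
    ≡⟨ cong₂ (λ a r → + a ℤ.* f zero ℤ.+ sumℤ (λ i → + greedy r m′ i ℤ.* f (suc i)))
             (ℕP.m≥n⇒m⊓n≡n k≤m₀) (ℕP.m≤n⇒m∸n≡0 k≤m₀) ⟩
  + k ℤ.* f zero ℤ.+ sumℤ (λ i → + greedy 0 m′ i ℤ.* f (suc i))
    ≡⟨ cong (ℤ._+_ (+ k ℤ.* f zero)) (sumℤ-cong (λ i → cong (λ x → + x ℤ.* f (suc i)) (greedy-zero m′ i))) ⟩
  + k ℤ.* f zero ℤ.+ sumℤ {n} (λ _ → + 0)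
    ≡⟨ cong (ℤ._+_ (+ k ℤ.* f zero)) (sumℤ-zero n) ⟩
  + k ℤ.* f zero ℤ.+ + 0
    ≡⟨ ℤP.+-identityʳ _ ⟩
  + k ℤ.* f zero ∎
  where
  open ≡-Reasoning
  m′ : Fin n → ℕ
  m′ i = m (suc i)

-- The conclusion says that greedy k m is k times the indicator vector of r.
greedy-concentrated : ∀ {n} k (m : Fin n → ℕ) → 1 ≤ k → k ≤ sumℕ m →
  (∀ i → 0 < greedy k m i → greedy k m i < m i) →
  ∃ λ r → ∀ (f : Fin n → ℤ) → sumℤ (λ i → + greedy k m i ℤ.* f i) ≡ + k ℤ.* f r
greedy-concentrated {zero}  k m 1≤k k≤0 _ = ⊥-elim (ℕP.<⇒≱ 1≤k k≤0)
greedy-concentrated {suc n} k m 1≤k k≤Σm unsaturated with k ℕP.≤? m zero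
... | yes k≤m₀ = zero , greedy-fits-first k m k≤m₀
... | no k≰m₀ = suc (proj₁ IH) , λ f → begin
  + greedy k m zero ℤ.* f zero ℤ.+ sumℤ (λ i → + greedy k m (suc i) ℤ.* f (suc i))
    ≡⟨ cong₂ (λ a b → + a ℤ.* f zero ℤ.+ b) (trans B₀≡m₀ m₀≡0)
             (sumℤ-cong (λ i → cong (λ x → + x ℤ.* f (suc i)) (greedy-skip k m m₀≡0 i))) ⟩
  + 0 ℤ.+ sumℤ (λ i → + greedy k m′ i ℤ.* f (suc i))
    ≡⟨ ℤP.+-identityˡ _ ⟩
  sumℤ (λ i → + greedy k m′ i ℤ.* f (suc i))
    ≡⟨ proj₂ IH (λ i → f (suc i)) ⟩
  + k ℤ.* f (suc (proj₁ IH)) ∎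
  where
  open ≡-Reasoning
  m′ : Fin n → ℕ
  m′ i = m (suc i)
  B₀≡m₀ : greedy k m zero ≡ m zero
  B₀≡m₀ = ℕP.m≤n⇒m⊓n≡m (ℕP.<⇒≤ (ℕP.≰⇒> k≰m₀))
  m₀≡0 : m zero ≡ 0
  m₀≡0 = ℕP.n≤0⇒n≡0 (ℕP.≮⇒≥ λ 0<m₀ →
    ℕP.<-irrefl B₀≡m₀ (unsaturated zero (subst (0 <_) (sym B₀≡m₀) 0<m₀)))
  IH : ∃ λ r → ∀ (f : Fin n → ℤ) → sumℤ (λ i → + greedy k m′ i ℤ.* f i) ≡ + k ℤ.* f r
  IH = greedy-concentrated k m′ 1≤k (subst (λ x → k ≤ x ℕ.+ sumℕ m′) m₀≡0 k≤Σm)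
         (λ i → subst (λ B → 0 < B → B < m′ i) (greedy-skip k m m₀≡0 i) (unsaturated (suc i)))

Even-+ : ∀ {a b} → Even a → Even b → Even (a ℤ.+ b)
Even-+ (x , refl) (y , refl) = x ℤ.+ y , sym (ℤP.*-distribˡ-+ (+ 2) x y)

Even-neg : ∀ {a} → Even a → Even (ℤ.- a)
Even-neg (x , refl) = ℤ.- x , ℤP.neg-distribʳ-* (+ 2) x

Even-* : ∀ a {b} → Even b → Even (a ℤ.* b)
Even-* a (y , refl) = a ℤ.* y , ident a y
  where
  ident : ∀ a y → a ℤ.* (+ 2 ℤ.* y) ≡ + 2 ℤ.* (a ℤ.* y)
  ident = solve-∀

Even-sumℤ : ∀ {n} (f : Fin n → ℤ) → (∀ i → Even (f i)) → Even (sumℤ f)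
Even-sumℤ {zero}  f _     = + 0 , refl
Even-sumℤ {suc n} f even = Even-+ (even zero) (Even-sumℤ (λ i → f (suc i)) (λ i → even (suc i)))

Even-double : ∀ a → Even (a ℤ.+ a)
Even-double a = a , ident a
  where
  ident : ∀ a → a ℤ.+ a ≡ + 2 ℤ.* a
  ident = solve-∀

double-minus≡⇒≡ : ∀ y z → y ℤ.+ y ℤ.- z ≡ z → y ≡ z
double-minus≡⇒≡ y z eq = ℤP.*-cancelˡ-≡ (+ 2) y z (begin
  + 2 ℤ.* y           ≡⟨ ident y z ⟩
  y ℤ.+ y ℤ.- z ℤ.+ z ≡⟨ cong (ℤ._+ z) eq ⟩
  z ℤ.+ z             ≡⟨ proj₂ (Even-double z) ⟩
  + 2 ℤ.* z           ∎)
  where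
  open ≡-Reasoning
  ident : ∀ y z → + 2 ℤ.* y ≡ y ℤ.+ y ℤ.- z ℤ.+ z
  ident = solve-∀

InScaledConv : ∀ {m n} → ℚ → (Fin m → Point n) → Point n → Set
InScaledConv {m} s v y = Σ (Fin m → ℚ) λ α →
  (∀ i → 0ℚ ℚ.≤ α i) × (sumℚ α ≡ s) × (∀ j → toℚ (y j) ≡ sumℚ (λ i → α i ℚ.* toℚ (v i j)))

δ : ∀ {m} → Fin m → Fin m → ℚ
δ zero    zero    = 1ℚ
δ zero    (suc _) = 0ℚ
δ (suc _) zero    = 0ℚ
δ (suc i) (suc l) = δ i l

δ-nonNeg : ∀ {m} (i l : Fin m) → 0ℚ ℚ.≤ δ i l
δ-nonNeg zero    zero    = ℚP.<⇒≤ (ℚP.positive⁻¹ 1ℚ)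
δ-nonNeg zero    (suc l) = ℚP.≤-refl
δ-nonNeg (suc i) zero    = ℚP.≤-refl
δ-nonNeg (suc i) (suc l) = δ-nonNeg i l

sumℚ-δ* : ∀ {m} (i : Fin m) (x : Fin m → ℚ) → sumℚ (λ l → δ i l ℚ.* x l) ≡ x i
sumℚ-δ* {suc m} zero x = begin
  1ℚ ℚ.* x zero ℚ.+ sumℚ (λ l → 0ℚ ℚ.* x (suc l))
    ≡⟨ cong₂ ℚ._+_ (ℚP.*-identityˡ (x zero)) (sumℚ-cong (λ l → ℚP.*-zeroˡ (x (suc l)))) ⟩
  x zero ℚ.+ sumℚ {m} (λ _ → 0ℚ)
    ≡⟨ cong (x zero ℚ.+_) (sumℚ-zero m) ⟩
  x zero ℚ.+ 0ℚ
    ≡⟨ ℚP.+-identityʳ (x zero) ⟩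
  x zero ∎
  where open ≡-Reasoning
sumℚ-δ* {suc m} (suc i) x =
  trans (cong₂ ℚ._+_ (ℚP.*-zeroˡ (x zero)) (sumℚ-δ* i (λ l → x (suc l)))) (ℚP.+-identityˡ _)

vertex-InConv : ∀ {m n} (v : Fin m → Point n) i → InConv v (v i)
vertex-InConv v i =
  δ i , δ-nonNeg i ,
  trans (sumℚ-cong (λ l → sym (ℚP.*-identityʳ (δ i l)))) (sumℚ-δ* i (λ _ → 1ℚ)) ,
  λ j → sym (sumℚ-δ* i (λ l → toℚ (v l j)))

InConv-scale⇒ : ∀ {m n} k {v : Fin m → Point n} {y} →
  InConv (scale k v) y → InScaledConv (toℚ (+ k)) v y
InConv-scale⇒ k {v} {y} (c , c≥0 , Σc , yc) = (λ i → K ℚ.* c i) , Kc≥0 , ΣKc , point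
  where
  K : ℚ
  K = toℚ (+ k)
  Kc≥0 : ∀ i → 0ℚ ℚ.≤ K ℚ.* c i
  Kc≥0 i = *-nonNeg (toℚ-nonNeg k) (c≥0 i)
  ΣKc : sumℚ (λ i → K ℚ.* c i) ≡ K
  ΣKc = trans (*-distribˡ-sumℚ K c) (trans (cong (K ℚ.*_) Σc) (ℚP.*-identityʳ K))
  point : ∀ j → toℚ (y j) ≡ sumℚ (λ i → K ℚ.* c i ℚ.* toℚ (v i j))
  point j = trans (yc j) (sumℚ-cong λ i →
    trans (cong (c i ℚ.*_) (toℚ-* (+ k) (v i j)))
          (solve 3 (λ K c V → c :* (K :* V) := K :* c :* V) refl K (c i) (toℚ (v i j))))

InConv-scale⇐ : ∀ {m n} {k} {v : Fin m → Point n} {y} → 1 ≤ k →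
  InScaledConv (toℚ (+ k)) v y → InConv (scale k v) y
InConv-scale⇐ {k = k} {v} {y} 1≤k (α , α≥0 , Σα , yα) = (λ i → α i ℚ.* w) , αw≥0 , Σαw , point
  where
  K : ℚ
  K = toℚ (+ k)
  instance
    K-positive : ℚ.Positive K
    K-positive = ℚ.positive (toℚ-mono-< (ℤ.+<+ 1≤k))
    K-nonZero : ℚ.NonZero K
    K-nonZero = ℚP.pos⇒nonZero K
  w : ℚ
  w = ℚ.1/ K
  wK≡1 : w ℚ.* K ≡ 1ℚ
  wK≡1 = ℚP.*-inverseˡ K
  αw≥0 : ∀ i → 0ℚ ℚ.≤ α i ℚ.* w
  αw≥0 i = *-nonNeg (α≥0 i) (ℚP.nonNegative⁻¹ w {{ℚP.pos⇒nonNeg w {{ℚP.1/pos⇒pos K}}}})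
  Σαw : sumℚ (λ i → α i ℚ.* w) ≡ 1ℚ
  Σαw = trans (*-distribʳ-sumℚ w α) (trans (cong (ℚ._* w) Σα) (trans (ℚP.*-comm K w) wK≡1))
  point : ∀ j → toℚ (y j) ≡ sumℚ (λ i → α i ℚ.* w ℚ.* toℚ (+ k ℤ.* v i j))
  point j = trans (yα j) (sumℚ-cong λ i → sym (begin
    α i ℚ.* w ℚ.* toℚ (+ k ℤ.* v i j)    ≡⟨ cong (α i ℚ.* w ℚ.*_) (toℚ-* (+ k) (v i j)) ⟩
    α i ℚ.* w ℚ.* (K ℚ.* toℚ (v i j))    ≡⟨ solve 4 (λ a w K V → a :* w :* (K :* V) := a :* (w :* K) :* V)
                                              refl (α i) w K (toℚ (v i j)) ⟩
    α i ℚ.* (w ℚ.* K) ℚ.* toℚ (v i j)    ≡⟨ cong (λ x → α i ℚ.* x ℚ.* toℚ (v i j)) wK≡1 ⟩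
    α i ℚ.* 1ℚ ℚ.* toℚ (v i j)           ≡⟨ cong (ℚ._* toℚ (v i j)) (ℚP.*-identityʳ (α i)) ⟩
    α i ℚ.* toℚ (v i j)                  ∎))
    where open ≡-Reasoning

combination : ∀ {m n} → (Fin m → ℕ) → (Fin m → Point n) → Point n
combination B v j = sumℤ (λ i → + B i ℤ.* v i j)

combination-InScaledConv : ∀ {m n k} (B : Fin m → ℕ) (v : Fin m → Point n) →
  sumℕ B ≡ k → InScaledConv (toℚ (+ k)) v (combination B v)
combination-InScaledConv B v ΣB≡k =
  (λ i → toℚ (+ B i)) , (λ i → toℚ-nonNeg (B i)) ,
  trans (sym (toℚ-sumℤ (λ i → + B i))) (cong toℚ (trans (sym (pos-sumℕ B)) (cong +_ ΣB≡k))) ,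
  λ j → trans (toℚ-sumℤ (λ i → + B i ℤ.* v i j)) (sumℚ-cong (λ i → toℚ-* (+ B i) (v i j)))

combination-even : ∀ {m n} (B : Fin m → ℕ) {v : Fin m → Point n} →
  (∀ i → EvenPt (v i)) → EvenPt (combination B v)
combination-even B v-even j = Even-sumℤ _ (λ i → Even-* (+ B i) (v-even i j))

reflect-InScaledConv : ∀ {m n s} {v : Fin m → Point n} {y z : Point n}
  (y∈ : InScaledConv s v y) (z∈ : InScaledConv s v z) →
  (∀ i → proj₁ z∈ i ℚ.≤ proj₁ y∈ i ℚ.+ proj₁ y∈ i) →
  InScaledConv s v (λ j → y j ℤ.+ y j ℤ.- z j)
reflect-InScaledConv {m} {s = s} {v} {y} {z} (α , _ , Σα , yα) (β , _ , Σβ , zβ) β≤2α =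
  γ , (λ i → p≤q⇒0≤q-p (β≤2α i)) , Σγ , point
  where
  γ : Fin m → ℚ
  γ i = α i ℚ.+ α i ℚ.- β i
  p≤q⇒0≤q-p : ∀ {p q} → p ℚ.≤ q → 0ℚ ℚ.≤ q ℚ.- p
  p≤q⇒0≤q-p {p} {q} p≤q = subst (ℚ._≤ q ℚ.- p) (ℚP.+-inverseʳ p) (ℚP.+-monoˡ-≤ (ℚ.- p) p≤q)
  Σγ : sumℚ γ ≡ s
  Σγ = begin
    sumℚ γ
      ≡⟨ sumℚ-distrib-- (λ i → α i ℚ.+ α i) β ⟩
    sumℚ (λ i → α i ℚ.+ α i) ℚ.- sumℚ β
      ≡⟨ cong₂ ℚ._-_ (trans (sumℚ-distrib-+ α α) (cong₂ ℚ._+_ Σα Σα)) Σβ ⟩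
    s ℚ.+ s ℚ.- s
      ≡⟨ solve 1 (λ s → s :+ s :- s := s) refl s ⟩
    s ∎
    where open ≡-Reasoning
  point : ∀ j → toℚ (y j ℤ.+ y j ℤ.- z j) ≡ sumℚ (λ i → γ i ℚ.* toℚ (v i j))
  point j = begin
    toℚ (y j ℤ.+ y j ℤ.- z j)
      ≡⟨ trans (toℚ-- (y j ℤ.+ y j) (z j)) (cong (ℚ._- toℚ (z j)) (toℚ-+ (y j) (y j))) ⟩
    toℚ (y j) ℚ.+ toℚ (y j) ℚ.- toℚ (z j)
      ≡⟨ cong₂ (λ p q → p ℚ.+ p ℚ.- q) (yα j) (zβ j) ⟩
    sumℚ αV ℚ.+ sumℚ αV ℚ.- sumℚ βV
      ≡⟨ sym (trans (sumℚ-distrib-- (λ i → αV i ℚ.+ αV i) βV) (cong (ℚ._- sumℚ βV) (sumℚ-distrib-+ αV αV))) ⟩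
    sumℚ (λ i → αV i ℚ.+ αV i ℚ.- βV i)
      ≡⟨ sumℚ-cong (λ i → solve 3 (λ a b V → a :* V :+ a :* V :- b :* V := (a :+ a :- b) :* V)
                                   refl (α i) (β i) (toℚ (v i j))) ⟩
    sumℚ (λ i → γ i ℚ.* toℚ (v i j)) ∎
    where
    open ≡-Reasoning
    αV βV : Fin m → ℚ
    αV i = α i ℚ.* toℚ (v i j)
    βV i = β i ℚ.* toℚ (v i j)

AffInd⇒weights-unique : ∀ {m n s} {v : Fin m → Point n} {y z : Point n} → AffInd v →
  (y∈ : InScaledConv s v y) (z∈ : InScaledConv s v z) → y ≐ z →
  ∀ i → proj₁ y∈ i ≡ proj₁ z∈ i
AffInd⇒weights-unique {s = s} {v} {y} {z} aff (α , _ , Σα , yα) (β , _ , Σβ , zβ) y≐z i =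
  x∙y⁻¹≈ε⇒x≈y (α i) (β i) (aff (λ i → α i ℚ.- β i) Σμ≡0 Σμv≡0 i)
  where
  Σμ≡0 : sumℚ (λ i → α i ℚ.- β i) ≡ 0ℚ
  Σμ≡0 = trans (sumℚ-distrib-- α β) (trans (cong₂ ℚ._-_ Σα Σβ) (ℚP.+-inverseʳ s))
  Σμv≡0 : ∀ j → sumℚ (λ i → (α i ℚ.- β i) ℚ.* toℚ (v i j)) ≡ 0ℚ
  Σμv≡0 j = begin
    sumℚ (λ i → (α i ℚ.- β i) ℚ.* toℚ (v i j))
      ≡⟨ sumℚ-cong (λ i → solve 3 (λ a b V → (a :- b) :* V := a :* V :- b :* V) refl (α i) (β i) (toℚ (v i j))) ⟩
    sumℚ (λ i → α i ℚ.* toℚ (v i j) ℚ.- β i ℚ.* toℚ (v i j))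
      ≡⟨ sumℚ-distrib-- (λ i → α i ℚ.* toℚ (v i j)) (λ i → β i ℚ.* toℚ (v i j)) ⟩
    sumℚ (λ i → α i ℚ.* toℚ (v i j)) ℚ.- sumℚ (λ i → β i ℚ.* toℚ (v i j))
      ≡⟨ cong₂ ℚ._-_ (sym (yα j)) (sym (zβ j)) ⟩
    toℚ (y j) ℚ.- toℚ (z j)
      ≡⟨ cong (λ x → toℚ (y j) ℚ.- toℚ x) (sym (y≐z j)) ⟩
    toℚ (y j) ℚ.- toℚ (y j)
      ≡⟨ ℚP.+-inverseʳ (toℚ (y j)) ⟩
    0ℚ ∎
    where open ≡-Reasoning

VertexOrMidpoint : ∀ {m n} → (Fin m → Point n) → (Point n → Set) → Point n → Set
VertexOrMidpoint v S y =
  (∃ λ i → y ≐ v i) ⊎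
  (Σ (Point _) λ z₁ → Σ (Point _) λ z₂ →
     S z₁ × S z₂ × EvenPt z₁ × EvenPt z₂ × ¬ (z₁ ≐ z₂) ×
     (∀ j → z₁ j ℤ.+ z₂ j ≡ + 2 ℤ.* y j))

module Mediation {n k : ℕ} {u : Fin n → Point n} (u-even : ∀ i → EvenPt (u i)) (u-aff : AffInd u)
  (1≤k : 1 ≤ k) (1≤n : 1 ≤ n) (n≤1+k : n ≤ suc k)
  {y : Point n} (y∈ : InScaledConv (toℚ (+ k)) u y) where

  α : Fin n → ℚ
  α = proj₁ y∈

  floor-2α : ∀ i → ∃ λ m → toℚ (+ m) ℚ.≤ α i ℚ.+ α i × α i ℚ.+ α i ℚ.< toℚ (+ suc m)
  floor-2α i = ∃-floor (α i ℚ.+ α i) (ℚP.+-mono-≤ (proj₁ (proj₂ y∈) i) (proj₁ (proj₂ y∈) i))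

  m : Fin n → ℕ
  m i = proj₁ (floor-2α i)

  k≤Σm : k ≤ sumℕ m
  k≤Σm = sum-floors-≥ k (λ i → α i ℚ.+ α i) m 1≤n n≤1+k Σ2α (λ i → proj₂ (proj₂ (floor-2α i)))
    where
    Σα : sumℚ α ≡ toℚ (+ k)
    Σα = proj₁ (proj₂ (proj₂ y∈))
    Σ2α : sumℚ (λ i → α i ℚ.+ α i) ≡ toℚ (+ (k ℕ.+ k))
    Σ2α = trans (sumℚ-distrib-+ α α) (trans (cong₂ ℚ._+_ Σα Σα) (sym (toℚ-double k)))

  B : Fin n → ℕ
  B = greedy k m

  z₂ : Point n
  z₂ = combination B u

  z₂∈ : InScaledConv (toℚ (+ k)) u z₂
  z₂∈ = combination-InScaledConv B u (greedy-sum k m k≤Σm)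

  z₁ : Point n
  z₁ j = y j ℤ.+ y j ℤ.- z₂ j

  z₁∈ : InScaledConv (toℚ (+ k)) u z₁
  z₁∈ = reflect-InScaledConv {v = u} {y} {z₂} y∈ z₂∈ λ i →
    ℚP.≤-trans (toℚ-mono-≤ (ℤ.+≤+ (greedy-≤ k m i))) (proj₁ (proj₂ (floor-2α i)))

  z₂-even : EvenPt z₂
  z₂-even = combination-even B u-even

  z₁-even : EvenPt z₁
  z₁-even j = Even-+ (Even-double (y j)) (Even-neg (z₂-even j))

  midpoint : ∀ j → z₁ j ℤ.+ z₂ j ≡ + 2 ℤ.* y j
  midpoint j = ident (y j) (z₂ j)
    where
    ident : ∀ y z → y ℤ.+ y ℤ.- z ℤ.+ z ≡ + 2 ℤ.* y
    ident = solve-∀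

  vertex : y ≐ z₂ → ∃ λ r → y ≐ scale k u r
  vertex y≐z₂ = proj₁ concentrated , λ j → trans (y≐z₂ j) (proj₂ concentrated (λ i → u i j))
    where
    2α≡2B : ∀ i → α i ℚ.+ α i ≡ toℚ (+ (B i ℕ.+ B i))
    2α≡2B i = trans (cong₂ ℚ._+_ α≡B α≡B) (sym (toℚ-double (B i)))
      where
      α≡B : α i ≡ toℚ (+ B i)
      α≡B = AffInd⇒weights-unique {v = u} {y} {z₂} u-aff y∈ z₂∈ y≐z₂ i
    m≡2B : ∀ i → m i ≡ B i ℕ.+ B i
    m≡2B i = floor-unique (subst (toℚ (+ m i) ℚ.≤_) (2α≡2B i) (proj₁ (proj₂ (floor-2α i))))
                          (subst (ℚ._< toℚ (+ suc (m i))) (2α≡2B i) (proj₂ (proj₂ (floor-2α i))))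
    concentrated : ∃ λ r → ∀ (f : Fin n → ℤ) → sumℤ (λ i → + B i ℤ.* f i) ≡ + k ℤ.* f r
    concentrated = greedy-concentrated k m 1≤k k≤Σm λ i 0<Bᵢ →
      subst (B i <_) (sym (m≡2B i)) (ℕP.m<m+n (B i) 0<Bᵢ)

  vertex-or-midpoint : VertexOrMidpoint (scale k u) (InConv (scale k u)) y
  vertex-or-midpoint with FinP.all? (λ j → y j ℤ.≟ z₂ j)
  ... | yes y≐z₂ = inj₁ (vertex y≐z₂)
  ... | no  y≭z₂ = inj₂ (z₁ , z₂ ,
    InConv-scale⇐ {v = u} {z₁} 1≤k z₁∈ , InConv-scale⇐ {v = u} {z₂} 1≤k z₂∈ ,
    z₁-even , z₂-even ,
    (λ z₁≐z₂ → y≭z₂ (λ j → double-minus≡⇒≡ (y j) (z₂ j) (z₁≐z₂ j))) ,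
    midpoint)

theorem3p5 : (n d k : ℕ) → 2 ≤ n → 1 ≤ d →
    (u : Fin n → Point n) →
    (∀ i j → + 0 ℤ.≤ u i j) → (∀ i → EvenPt (u i)) →
    (∀ i → sumℤ (u i) ≡ + (2 Data.Nat.* d)) →
    AffInd u →
    n ∸ 1 ≤ k →
    Mediated (scale k u) (InConv (scale k u))
theorem3p5 n d k 2≤n _ u _ u-even _ u-aff n∸1≤k =
  (λ _ y∈ → y∈) ,
  vertex-InConv (scale k u) ,
  λ y y∈ → Mediation.vertex-or-midpoint u-even u-aff 1≤k 1≤n n≤1+k (InConv-scale⇒ k {u} {y} y∈)
  where
  1≤k : 1 ≤ k
  1≤k = ℕP.≤-trans (ℕP.∸-monoˡ-≤ 1 2≤n) n∸1≤k
  1≤n : 1 ≤ n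
  1≤n = ℕP.≤-trans (s≤s z≤n) 2≤n
  n≤1+k : n ≤ suc k
  n≤1+k = ℕP.≤-trans (ℕP.m≤n+m∸n n 1) (s≤s n∸1≤k)
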